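{- Let $r$ be a positive integer, let $n,k$ be nonnegative integers and $m=n+k$. Let $M$, $N$, $K$ be the multisets $$M=\Bigl\{\Bigl\lceil\tfrac{m-j}{r}\Bigr\rceil: 0\le j\le r-1\Bigr\},\quad N=\Bigl\{\Bigl\lceil\tfrac{n-j}{r}\Bigr\rceil: 0\le j\le r-1\Bigr\},\quad K=\Bigl\{\Bigl\lceil\tfrac{k-j}{r}\Bigr\rceil: 0\le j\le r-1\Bigr\}$$ (each with $r$ elements counted with multiplicity). Then there exist orderings $(M_1,\dots,M_r)$, $(N_1,\dots,N_r)$, $(K_1,\dots,K_r)$ of the elements of $M$, $N$, $K$ respectively such that $M_i=N_i+K_i$ for all $1\le i\le r$. -}

module Defs where

open import Data.Nat as ℕ using (ℕ; NonZero)
open import Data.Integer using (ℤ; +_; -_; _-_; _/ℕ_)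
open import Data.Fin using (Fin; toℕ)

-- Ceiling of the rational a / r for an integer a and a positive natural r:
-- ⌈ a / r ⌉ = - ⌊ (- a) / r ⌋   (_/ℕ_ on ℤ is floor division).
⌈_/_⌉ : (a : ℤ) (r : ℕ) .{{_ : NonZero r}} → ℤ
⌈ a / r ⌉ = - ((- a) /ℕ r)

-- The multiset { ⌈ (x - j) / r ⌉ : 0 ≤ j ≤ r - 1 }, presented as an
-- r-tuple indexed by j ∈ Fin r (multiplicities are those of the tuple).
ceilMultiset : (r : ℕ) .{{_ : NonZero r}} → ℕ → Fin r → ℤ
ceilMultiset r x j = ⌈ (+ x) - (+ toℕ j) / r ⌉

-- Every integer a can be written uniquely as a = ⌈a/r⌉·r − δ(a) with a deficit
-- 0 ≤ δ(a) < r. Substituting this for a = n − j into n + k − j gives the carry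
-- rule ⌈(n+k−j)/r⌉ = ⌈(n−j)/r⌉ + ⌈(k−δ(n−j))/r⌉, and j ↦ δ(n−j), the residue of
-- j − n modulo r, permutes {0, …, r−1}; so M_j = N_j + K_{δ(n−j)}.
module Submission where

open import Defs
open import Data.Nat as ℕ using (ℕ; _+_; NonZero)
open import Data.Integer using (ℤ; +_; -_; _-_; _*_; _/ℕ_; _%ℕ_; _<_; +<+; suc)
  renaming (_+_ to _+ℤ_)
open import Data.Integer.Properties
open import Data.Integer.DivMod using (a≡a%ℕn+[a/ℕn]*n; n%ℕd<d)
open import Data.Integer.Tactic.RingSolver using (solve-∀)
open import Data.Fin using (Fin; toℕ; fromℕ<)
open import Data.Fin.Properties using (toℕ-injective; toℕ-fromℕ<; toℕ<n)
open import Data.Fin.Permutation using (Permutation′; _⟨$⟩ʳ_; permutation; id)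
open import Data.Empty using (⊥-elim)
open import Data.Product using (Σ-syntax; _,_; _×_; proj₁; proj₂)
open import Relation.Binary using (tri<; tri≈; tri>)
open import Relation.Binary.PropositionalEquality
  using (_≡_; refl; sym; trans; cong; subst; module ≡-Reasoning)

module _ (r : ℕ) .{{_ : NonZero r}} where

  deficit : ℤ → ℕ
  deficit a = (- a) %ℕ r

  deficit<r : ∀ a → deficit a ℕ.< r
  deficit<r a = n%ℕd<d (- a) r

  a≡⌈a/r⌉*r-deficit : ∀ a → a ≡ ⌈ a / r ⌉ * + r - + deficit a
  a≡⌈a/r⌉*r-deficit a = begin
    a                        ≡⟨ neg-involutive a ⟨
    - (- a)                  ≡⟨ cong -_ (a≡a%ℕn+[a/ℕn]*n (- a) r) ⟩
    - (+ s +ℤ q * + r)       ≡⟨ negate (+ s) q (+ r) ⟩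
    (- q) * + r - + s        ∎
    where
    open ≡-Reasoning
    s = deficit a
    q = (- a) /ℕ r
    negate : ∀ x y z → - (x +ℤ y * z) ≡ (- y) * z - x
    negate = solve-∀

  c*r-s-monoˡ-< : ∀ {c c' s s'} → s' ℕ.< r → c < c' → c * + r - + s < c' * + r - + s'
  c*r-s-monoˡ-< {c} {c'} {s} {s'} s'<r c<c' = begin-strict
    c * + r - + s                ≤⟨ i-j≤i (c * + r) (+ s) ⟩
    c * + r                      ≡⟨ add-sub (c * + r) (+ s') ⟩
    (+ s' +ℤ c * + r) - + s'     <⟨ +-monoˡ-< (- + s') (+-monoˡ-< (c * + r) (+<+ s'<r)) ⟩
    (+ r +ℤ c * + r) - + s'      ≡⟨ cong (_- + s') (suc-* c (+ r)) ⟨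
    suc c * + r - + s'           ≤⟨ +-monoˡ-≤ (- + s') (*-monoʳ-≤-nonNeg (+ r) (i<j⇒suc[i]≤j c<c')) ⟩
    c' * + r - + s'              ∎
    where
    open ≤-Reasoning
    add-sub : ∀ x y → x ≡ (y +ℤ x) - y
    add-sub = solve-∀

  c*r-s-injective : ∀ {c c' s s'} → s ℕ.< r → s' ℕ.< r →
                      c * + r - + s ≡ c' * + r - + s' → c ≡ c' × s ≡ s'
  c*r-s-injective {c} {c'} {s} {s'} s<r s'<r eq with <-cmp c c'
  ... | tri< c<c' _ _ = ⊥-elim (<-irrefl eq (c*r-s-monoˡ-< s'<r c<c'))
  ... | tri> _ _ c>c' = ⊥-elim (<-irrefl (sym eq) (c*r-s-monoˡ-< s<r c>c'))
  ... | tri≈ _ refl _ = refl , +-injective (begin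
    + s                          ≡⟨ sub-sub (c * + r) (+ s) ⟩
    c * + r - (c * + r - + s)    ≡⟨ cong (λ y → c * + r - y) eq ⟩
    c * + r - (c * + r - + s')   ≡⟨ sub-sub (c * + r) (+ s') ⟨
    + s'                         ∎)
    where
    open ≡-Reasoning
    sub-sub : ∀ x y → y ≡ x - (x - y)
    sub-sub = solve-∀

  ceiling-unique : ∀ {a c s} → s ℕ.< r → a ≡ c * + r - + s → ⌈ a / r ⌉ ≡ c × deficit a ≡ s
  ceiling-unique {a} s<r eq =
    c*r-s-injective (deficit<r a) s<r (trans (sym (a≡⌈a/r⌉*r-deficit a)) eq)

  ⌈a+b/r⌉-carry : ∀ a b → ⌈ a +ℤ b / r ⌉ ≡ ⌈ a / r ⌉ +ℤ ⌈ b - + deficit a / r ⌉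
  ⌈a+b/r⌉-carry a b = proj₁ (ceiling-unique (deficit<r b') (begin
    a +ℤ b                          ≡⟨ cong (_+ℤ b) (a≡⌈a/r⌉*r-deficit a) ⟩
    (c₁ * + r - + s₁) +ℤ b          ≡⟨ shift (c₁ * + r) (+ s₁) b ⟩
    c₁ * + r +ℤ b'                  ≡⟨ cong (c₁ * + r +ℤ_) (a≡⌈a/r⌉*r-deficit b') ⟩
    c₁ * + r +ℤ (c₂ * + r - + s₂)   ≡⟨ collect c₁ c₂ (+ r) (+ s₂) ⟩
    (c₁ +ℤ c₂) * + r - + s₂         ∎))
    where
    open ≡-Reasoning
    c₁ = ⌈ a / r ⌉
    s₁ = deficit a
    b' = b - + s₁
    c₂ = ⌈ b' / r ⌉
    s₂ = deficit b'
    shift : ∀ x y z → (x - y) +ℤ z ≡ x +ℤ (z - y)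
    shift = solve-∀
    collect : ∀ x y z w → x * z +ℤ (y * z - w) ≡ (x +ℤ y) * z - w
    collect = solve-∀

  deficit-reflect : ∀ a {t} → t ℕ.< r → deficit (a - + deficit (- a - + t)) ≡ t
  deficit-reflect a {t} t<r = proj₂ (ceiling-unique {c = - c} t<r (begin
    a - + s                         ≡⟨ expand a (c * + r) (+ s) ⟩
    (a +ℤ (c * + r - + s)) - c * + r ≡⟨ cong (λ y → (a +ℤ y) - c * + r) (a≡⌈a/r⌉*r-deficit u) ⟨
    (a +ℤ (- a - + t)) - c * + r    ≡⟨ cancel a c (+ r) (+ t) ⟩
    (- c) * + r - + t               ∎))
    where
    open ≡-Reasoning
    u = - a - + t
    c = ⌈ u / r ⌉
    s = deficit u
    expand : ∀ x y z → x - z ≡ (x +ℤ (y - z)) - y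
    expand = solve-∀
    cancel : ∀ x y z w → (x +ℤ (- x - w)) - y * z ≡ (- y) * z - w
    cancel = solve-∀

  reflect : ℤ → Fin r → Fin r
  reflect a i = fromℕ< (deficit<r (a - + toℕ i))

  toℕ-reflect : ∀ a i → toℕ (reflect a i) ≡ deficit (a - + toℕ i)
  toℕ-reflect a i = toℕ-fromℕ< (deficit<r (a - + toℕ i))

  reflect-inverse : ∀ a t → reflect a (reflect (- a) t) ≡ t
  reflect-inverse a t = toℕ-injective (begin
    toℕ (reflect a (reflect (- a) t))         ≡⟨ toℕ-reflect a (reflect (- a) t) ⟩
    deficit (a - + toℕ (reflect (- a) t))     ≡⟨ cong (λ z → deficit (a - + z)) (toℕ-reflect (- a) t) ⟩
    deficit (a - + deficit (- a - + toℕ t))   ≡⟨ deficit-reflect a (toℕ<n t) ⟩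
    toℕ t                                     ∎)
    where open ≡-Reasoning

  reflectPermutation : ℤ → Permutation′ r
  reflectPermutation a = permutation (reflect a) (reflect (- a)) (reflect-inverse a)
    (λ i → subst (λ b → reflect (- a) (reflect b i) ≡ i) (neg-involutive a) (reflect-inverse (- a) i))

theorem4p4 : (r : ℕ) .{{_ : NonZero r}} (n k : ℕ) →
    Σ[ σ ∈ Permutation′ r ] Σ[ τ ∈ Permutation′ r ] Σ[ ρ ∈ Permutation′ r ] ((i : Fin r) →
      ceilMultiset r (n + k) (σ ⟨$⟩ʳ i)
        ≡ ceilMultiset r n (τ ⟨$⟩ʳ i) +ℤ ceilMultiset r k (ρ ⟨$⟩ʳ i))
theorem4p4 r n k = id , id , reflectPermutation r (+ n) , λ i → begin
  ⌈ + (n + k) - + toℕ i / r ⌉                    ≡⟨ cong ⌈_/ r ⌉ (shuffle (toℕ i)) ⟩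
  ⌈ (+ n - + toℕ i) +ℤ + k / r ⌉                 ≡⟨ ⌈a+b/r⌉-carry r (+ n - + toℕ i) (+ k) ⟩
  ⌈ + n - + toℕ i / r ⌉ +ℤ ⌈ + k - + deficit r (+ n - + toℕ i) / r ⌉
      ≡⟨ cong (λ z → ⌈ + n - + toℕ i / r ⌉ +ℤ ⌈ + k - + z / r ⌉) (toℕ-reflect r (+ n) i) ⟨
  ceilMultiset r n i +ℤ ceilMultiset r k (reflect r (+ n) i) ∎
  where
  open ≡-Reasoning
  reassoc : ∀ x y z → (x +ℤ y) - z ≡ (x - z) +ℤ y
  reassoc = solve-∀
  shuffle : ∀ j → + (n + k) - + j ≡ (+ n - + j) +ℤ + k
  shuffle j = trans (cong (_- + j) (pos-+ n k)) (reassoc (+ n) (+ k) (+ j))
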